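{- Every semi-Heyting algebra satisfying $x\to y\approx y\to x$ satisfies $(x^*\to x)^*\approx1$. Hence $\mathbb{SH}_c\subseteq\mathbb{AT}1$.
   Context: A semi-Heyting algebra is an algebra $\langle A;\wedge,\vee,\to,0,1\rangle$ such that $\langle A;\wedge,\vee,0,1\rangle$ is a bounded lattice and the identities $x\wedge(x\to y)\approx x\wedge y$, $x\wedge(y\to z)\approx x\wedge((x\wedge y)\to(x\wedge z))$, $x\to x\approx1$ hold. Write $x^*:=x\to0$. $\mathbb{SH}_c$ is the variety of semi-Heyting algebras satisfying $x\to y\approx y\to x$, and $\mathbb{AT}1$ is the variety of semi-Heyting algebras satisfying $(x^*\to x)^*\approx1$. -}

module Defs where

open import Level using (Level; _⊔_; suc)
open import Relation.Binary.Core using (Rel)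
open import Algebra.Core using (Op₂)
open import Algebra.Definitions using (Congruent₂)
open import Algebra.Lattice.Structures using (IsLattice)

record SemiHeytingAlgebra (c ℓ : Level) : Set (suc (c ⊔ ℓ)) where
  infixr 5 _⇒_
  infixr 6 _∨_
  infixr 7 _∧_
  infix  4 _≈_
  field
    Carrier   : Set c
    _≈_       : Rel Carrier ℓ
    _∧_       : Op₂ Carrier
    _∨_       : Op₂ Carrier
    _⇒_       : Op₂ Carrier
    𝟘         : Carrier
    𝟙         : Carrier
    isLattice : IsLattice _≈_ _∨_ _∧_
    ⇒-cong    : Congruent₂ _≈_ _⇒_
    𝟘-least   : ∀ x → 𝟘 ∧ x ≈ 𝟘
    𝟙-greatest : ∀ x → x ∨ 𝟙 ≈ 𝟙
    sh1       : ∀ x y → x ∧ (x ⇒ y) ≈ x ∧ y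
    sh2       : ∀ x y z → x ∧ (y ⇒ z) ≈ x ∧ ((x ∧ y) ⇒ (x ∧ z))
    sh3       : ∀ x → x ⇒ x ≈ 𝟙

  open IsLattice isLattice public

  _* : Carrier → Carrier
  x * = x ⇒ 𝟘

SatisfiesComm : ∀ {c ℓ} → SemiHeytingAlgebra c ℓ → Set (c ⊔ ℓ)
SatisfiesComm A = ∀ x y → x ⇒ y ≈ y ⇒ x
  where open SemiHeytingAlgebra A

SatisfiesAT1 : ∀ {c ℓ} → SemiHeytingAlgebra c ℓ → Set (c ⊔ ℓ)
SatisfiesAT1 A = ∀ x → ((x *) ⇒ x) * ≈ 𝟙
  where open SemiHeytingAlgebra A

-- With b := x* → x we always have b ∧ x* ≈ x* ∧ x ≈ 0, and commutativity
-- (b ≈ x → x*) gives b ∧ x ≈ x ∧ x* ≈ 0 as well.  In a semi-Heyting algebra an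
-- element disjoint from x lies below x*, hence b ≈ b ∧ x* ≈ 0 and b* ≈ 0 → 0 ≈ 1.
module Submission where

open import Defs
open import Level using (Level)
open import Relation.Binary.Bundles using (Setoid)
import Relation.Binary.Reasoning.Setoid as SetoidReasoning

module SemiHeytingProperties {c ℓ} (A : SemiHeytingAlgebra c ℓ) where
  open SemiHeytingAlgebra A

  setoid : Setoid c ℓ
  setoid = record { isEquivalence = isEquivalence }

  open SetoidReasoning setoid

  ∧-identityʳ : ∀ x → x ∧ 𝟙 ≈ x
  ∧-identityʳ x = begin
    x ∧ 𝟙        ≈⟨ ∧-congˡ (sym (𝟙-greatest x)) ⟩
    x ∧ (x ∨ 𝟙)  ≈⟨ ∧-absorbs-∨ x 𝟙 ⟩
    x            ∎

  ∧-zeroʳ : ∀ x → x ∧ 𝟘 ≈ 𝟘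
  ∧-zeroʳ x = trans (∧-comm x 𝟘) (𝟘-least x)

  𝟘*≈𝟙 : 𝟘 * ≈ 𝟙
  𝟘*≈𝟙 = sh3 𝟘

  x∧x*≈𝟘 : ∀ x → x ∧ x * ≈ 𝟘
  x∧x*≈𝟘 x = trans (sh1 x 𝟘) (∧-zeroʳ x)

  [x*⇒x]∧x*≈𝟘 : ∀ x → (x * ⇒ x) ∧ x * ≈ 𝟘
  [x*⇒x]∧x*≈𝟘 x = begin
    (x * ⇒ x) ∧ x *  ≈⟨ ∧-comm (x * ⇒ x) (x *) ⟩
    x * ∧ (x * ⇒ x)  ≈⟨ sh1 (x *) x ⟩
    x * ∧ x          ≈⟨ ∧-comm (x *) x ⟩
    x ∧ x *          ≈⟨ x∧x*≈𝟘 x ⟩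
    𝟘                ∎

  ∧≈𝟘⇒∧*-absorbs : ∀ {x y} → y ∧ x ≈ 𝟘 → y ∧ x * ≈ y
  ∧≈𝟘⇒∧*-absorbs {x} {y} y∧x≈𝟘 = begin
    y ∧ (x ⇒ 𝟘)            ≈⟨ sh2 y x 𝟘 ⟩
    y ∧ (y ∧ x ⇒ y ∧ 𝟘)    ≈⟨ ∧-congˡ (⇒-cong y∧x≈𝟘 (∧-zeroʳ y)) ⟩
    y ∧ 𝟘 *                ≈⟨ ∧-congˡ 𝟘*≈𝟙 ⟩
    y ∧ 𝟙                  ≈⟨ ∧-identityʳ y ⟩
    y                      ∎

  disjoint-from-x-and-x*⇒≈𝟘 : ∀ {x y} → y ∧ x ≈ 𝟘 → y ∧ x * ≈ 𝟘 → y ≈ 𝟘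
  disjoint-from-x-and-x*⇒≈𝟘 y∧x≈𝟘 y∧x*≈𝟘 =
    trans (sym (∧≈𝟘⇒∧*-absorbs y∧x≈𝟘)) y∧x*≈𝟘

module CommutativeSemiHeytingProperties
  {c ℓ} (A : SemiHeytingAlgebra c ℓ) (comm : SatisfiesComm A) where
  open SemiHeytingAlgebra A
  open SemiHeytingProperties A
  open SetoidReasoning setoid

  [x*⇒x]∧x≈𝟘 : ∀ x → (x * ⇒ x) ∧ x ≈ 𝟘
  [x*⇒x]∧x≈𝟘 x = begin
    (x * ⇒ x) ∧ x  ≈⟨ ∧-comm (x * ⇒ x) x ⟩
    x ∧ (x * ⇒ x)  ≈⟨ ∧-congˡ (comm (x *) x) ⟩
    x ∧ (x ⇒ x *)  ≈⟨ sh1 x (x *) ⟩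
    x ∧ x *        ≈⟨ x∧x*≈𝟘 x ⟩
    𝟘              ∎

  x*⇒x≈𝟘 : ∀ x → x * ⇒ x ≈ 𝟘
  x*⇒x≈𝟘 x = disjoint-from-x-and-x*⇒≈𝟘 ([x*⇒x]∧x≈𝟘 x) ([x*⇒x]∧x*≈𝟘 x)

theorem7p9 : ∀ {c ℓ : Level} (A : SemiHeytingAlgebra c ℓ) → SatisfiesComm A → SatisfiesAT1 A
theorem7p9 A comm x = trans (⇒-cong (x*⇒x≈𝟘 x) refl) 𝟘*≈𝟙
  where
  open SemiHeytingAlgebra A
  open SemiHeytingProperties A
  open CommutativeSemiHeytingProperties A comm
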